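{- There is an absolute constant $c$ such that for every instance $(A,k)$ of \textsc{Unary Bin Packing} with $B=\sum_{j}a_j/k\in\mathbb N$, the graph $G$ constructed from it as described in the context satisfies $\mathrm{cvd}(G)\le c\cdot k$, i.e. $\mathrm{cvd}(G)=O(k)$.
   Context: $\mathrm{cvd}(G)$ is the minimum size of a set $S\subseteq V(G)$ such that every connected component of $G-S$ is a clique. An instance of \textsc{Unary Bin Packing} consists of non-negative integers $A=\{a_1,\dots,a_n\}$ and $k\in\mathbb N$. $[x,y]=\{x,\dots,y\}$, $[x]=[1,x]$. Construction of $G$: (1) a clique $X$ on $x_1,\dots,x_{2kB+B}$ and a clique $Y$ on $y_1,\dots,y_{2kB+B}$; $X^i=\{x_{2iB-B+2},\dots,x_{2iB+B+1}\}$ for $i\in[k-1]$, $X^k=\{x_{2kB-B+2},\dots,x_{2kB+B}\}$, $Y^1=\{y_1,\dots,y_{3B-1}\}$, $Y^i=\{y_{2iB-B},\dots,y_{2iB+B-1}\}$ for $i\in[2,k]$. (2) For each $i\in[k]$ a clique on $L^i\cup R^i$, $L^i=\{\ell^i_1,\dots,\ell^i_B\}$, $R^i=\{r^i_1,\dots,r^i_B\}$, with edges: $\ell^i_1$ to every $x\in\bigcup_{j=i}^kX^j$; $x_{2iB+B+1}$ to every vertex of $L^i$ for $i\in[k-1]$; $x_{2kB+B}$ to every vertex of $L^k$; $r^i_B$ to every $y\in\bigcup_{j=1}^iY^j$; $y_{2iB-B}$ to every vertex of $R^i$ for $i\in[2,k]$; $y_1$ to every vertex of $R^1$. (3) For each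 $j\in[n]$ a clique on $A^{j,L}\cup A^{j,R}$, each part of size $a_j$; edges from $x_{2kB+B}$ to every vertex of $\bigcup_jA^{j,L}$ and from $y_1$ to every vertex of $\bigcup_jA^{j,R}$. No other vertices or edges. -}

module Defs where

open import Data.Nat using (ℕ; zero; suc; _+_; _*_; _∸_; _≤_; _<_)
open import Data.List using (List; []; _∷_; length)
open import Data.List.Membership.Propositional using (_∉_)
open import Data.Product using (_×_; Σ; ∃-syntax; _,_)
open import Data.Sum using (_⊎_)
open import Relation.Binary.PropositionalEquality using (_≡_; _≢_)

-- a_j for j ∈ [1,n] (1-based); 0 outside the range (never used there,
-- since vertex validity then requires 1 ≤ s ≤ 0).
at : List ℕ → ℕ → ℕ
at []       _             = 0
at (a ∷ as) zero          = 0
at (a ∷ as) (suc zero)    = a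
at (a ∷ as) (suc (suc j)) = at as (suc j)

_∈[_,_] : ℕ → ℕ → ℕ → Set
x ∈[ lo , hi ] = lo ≤ x × x ≤ hi

data V : Set where
  xv : ℕ → V
  yv : ℕ → V
  lv : ℕ → ℕ → V      -- ℓ^i_s
  rv : ℕ → ℕ → V      -- r^i_s
  aL : ℕ → ℕ → V      -- s-th vertex of A^{j,L}
  aR : ℕ → ℕ → V      -- s-th vertex of A^{j,R}

module Construction (As : List ℕ) (k B : ℕ) where

  n : ℕ
  n = length As

  N : ℕ
  N = 2 * k * B + B

  -- vertex set of G
  Valid : V → Set
  Valid (xv a)   = a ∈[ 1 , N ]
  Valid (yv a)   = a ∈[ 1 , N ]
  Valid (lv i s) = i ∈[ 1 , k ] × s ∈[ 1 , B ]
  Valid (rv i s) = i ∈[ 1 , k ] × s ∈[ 1 , B ]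
  Valid (aL j s) = j ∈[ 1 , n ] × s ∈[ 1 , at As j ]
  Valid (aR j s) = j ∈[ 1 , n ] × s ∈[ 1 , at As j ]

  -- index sets X^i and Y^i
  InX : ℕ → ℕ → Set
  InX i a = (i ∈[ 1 , k ∸ 1 ] × a ∈[ 2 * i * B ∸ B + 2 , 2 * i * B + B + 1 ])
          ⊎ (i ≡ k × a ∈[ 2 * k * B ∸ B + 2 , 2 * k * B + B ])

  InY : ℕ → ℕ → Set
  InY i a = (i ≡ 1 × a ∈[ 1 , 3 * B ∸ 1 ])
          ⊎ (i ∈[ 2 , k ] × a ∈[ 2 * i * B ∸ B , 2 * i * B + B ∸ 1 ])

  -- edges, listed in one orientation
  data E : V → V → Set where
    xx : ∀ {a b} → a ≢ b → E (xv a) (xv b)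
    yy : ∀ {a b} → a ≢ b → E (yv a) (yv b)
    ll : ∀ {i s t} → s ≢ t → E (lv i s) (lv i t)
    rr : ∀ {i s t} → s ≢ t → E (rv i s) (rv i t)
    lr : ∀ {i s t} → E (lv i s) (rv i t)
    l1X : ∀ {i a} → (∃[ j ] (j ∈[ i , k ] × InX j a)) → E (lv i 1) (xv a)
    xL : ∀ {i s} → i ∈[ 1 , k ∸ 1 ] → E (xv (2 * i * B + B + 1)) (lv i s)
    xLk : ∀ {s} → E (xv (2 * k * B + B)) (lv k s)
    rBY : ∀ {i a} → (∃[ j ] (j ∈[ 1 , i ] × InY j a)) → E (rv i B) (yv a)
    yR : ∀ {i s} → i ∈[ 2 , k ] → E (yv (2 * i * B ∸ B)) (rv i s)
    y1R : ∀ {s} → E (yv 1) (rv 1 s)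
    aLL : ∀ {j s t} → s ≢ t → E (aL j s) (aL j t)
    aRR : ∀ {j s t} → s ≢ t → E (aR j s) (aR j t)
    aLR : ∀ {j s t} → E (aL j s) (aR j t)
    xA : ∀ {j s} → E (xv (2 * k * B + B)) (aL j s)
    yA : ∀ {j s} → E (yv 1) (aR j s)

  Adj : V → V → Set
  Adj u v = Valid u × Valid v × (E u v ⊎ E v u)

  InGminus : List V → V → Set
  InGminus S v = Valid v × v ∉ S

  data Reach (S : List V) : V → V → Set where
    here : ∀ {u} → InGminus S u → Reach S u u
    step : ∀ {u w v} → InGminus S u → InGminus S w → Adj u w →
           Reach S w v → Reach S u v

  IsClusterDeletion : List V → Set
  IsClusterDeletion S = ∀ u v → Reach S u v → u ≡ v ⊎ Adj u v

  -- cvd(G) ≤ m  (cvd is a minimum, so this is: some deletion set has size ≤ m)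
  CvdAtMost : ℕ → Set
  CvdAtMost m = ∃[ S ] (length S ≤ m × IsClusterDeletion S)

{-# OPTIONS --safe #-}
-- Delete x_{2kB+B}, y_1 and, for every i ∈ [k], the four vertices ℓ^i_1, r^i_B,
-- x_{2iB+B+1}, y_{2iB-B}.  Every edge of G that leaves one of the cliques X, Y,
-- L^i ∪ R^i, A^{j,L} ∪ A^{j,R} has one of these vertices as an endpoint, so the
-- components of what remains are exactly those cliques: 4k + 2 ≤ 6k deletions.
module Submission where

open import Defs
open import Data.Nat using (ℕ; _*_; _≤_)
open import Data.List using (List)
open import Data.Nat.ListAction using (sum)
open import Data.Product using (∃-syntax)
open import Relation.Binary.PropositionalEquality using (_≡_)

open import Data.Nat using (zero; suc; _+_; _∸_; z≤n; s≤s; _≟_)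
open import Data.Nat.Properties
  using (≤∧≢⇒<; m<1+n⇒m≤n; m∸n≤m; ≤-trans; *-suc; *-monoʳ-≤; *-distribʳ-+; +-monoˡ-≤; module ≤-Reasoning)
open import Data.List using ([]; _∷_; _++_; length)
open import Data.List.Properties using (length-++)
open import Data.List.Membership.Propositional using (_∈_)
open import Data.List.Membership.Propositional.Properties using (∈-++⁺ˡ; ∈-++⁺ʳ)
open import Data.List.Relation.Unary.Any using (here; there)
open import Data.Product using (_×_; _,_)
open import Data.Sum using (_⊎_; inj₁; inj₂)
open import Data.Empty using (⊥-elim)
open import Relation.Nullary using (yes; no)
open import Relation.Binary.PropositionalEquality using (_≢_; refl; sym; trans; cong; subst)

data Block : Set where
  X Y : Block
  LR A : ℕ → Block

block : V → Block
block (xv _)   = X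
block (yv _)   = Y
block (lv i _) = LR i
block (rv i _) = LR i
block (aL j _) = A j
block (aR j _) = A j

data InBlock : Block → V → Set where
  x∈X  : ∀ {a} → InBlock X (xv a)
  y∈Y  : ∀ {a} → InBlock Y (yv a)
  ℓ∈LR : ∀ {i s} → InBlock (LR i) (lv i s)
  r∈LR : ∀ {i s} → InBlock (LR i) (rv i s)
  L∈A  : ∀ {j s} → InBlock (A j) (aL j s)
  R∈A  : ∀ {j s} → InBlock (A j) (aR j s)

inBlock : ∀ v → InBlock (block v) v
inBlock (xv _)   = x∈X
inBlock (yv _)   = y∈Y
inBlock (lv _ _) = ℓ∈LR
inBlock (rv _ _) = r∈LR
inBlock (aL _ _) = L∈A
inBlock (aR _ _) = R∈A

module _ (As : List ℕ) (k B : ℕ) where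
  open Construction As k B

  ≡⊎Adj-family : (f : ℕ → V) → (∀ {a b} → a ≢ b → E (f a) (f b)) →
                 ∀ {a b} → Valid (f a) → Valid (f b) → f a ≡ f b ⊎ Adj (f a) (f b)
  ≡⊎Adj-family f edge {a} {b} va vb with a ≟ b
  ... | yes refl = inj₁ refl
  ... | no a≢b   = inj₂ (va , vb , inj₁ (edge a≢b))

  block-isClique : ∀ {b u v} → InBlock b u → InBlock b v →
                   Valid u → Valid v → u ≡ v ⊎ Adj u v
  block-isClique x∈X  x∈X  = ≡⊎Adj-family xv xx
  block-isClique y∈Y  y∈Y  = ≡⊎Adj-family yv yy
  block-isClique ℓ∈LR ℓ∈LR = ≡⊎Adj-family (lv _) ll
  block-isClique r∈LR r∈LR = ≡⊎Adj-family (rv _) rr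
  block-isClique L∈A  L∈A  = ≡⊎Adj-family (aL _) aLL
  block-isClique R∈A  R∈A  = ≡⊎Adj-family (aR _) aRR
  block-isClique ℓ∈LR r∈LR = λ vu vv → inj₂ (vu , vv , inj₁ lr)
  block-isClique r∈LR ℓ∈LR = λ vu vv → inj₂ (vu , vv , inj₂ lr)
  block-isClique L∈A  R∈A  = λ vu vv → inj₂ (vu , vv , inj₁ aLR)
  block-isClique R∈A  L∈A  = λ vu vv → inj₂ (vu , vv , inj₂ aLR)

  Reach-valid : ∀ {S u v} → Reach S u v → Valid u × Valid v
  Reach-valid (here (vu , _)) = vu , vu
  Reach-valid (step (vu , _) _ _ r) with Reach-valid r
  ... | _ , vv = vu , vv

  Reach-invariant : ∀ {S} {C : Set} (f : V → C) →
                    (∀ {u w} → InGminus S u → E u w → f u ≡ f w) →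
                    ∀ {u v} → Reach S u v → f u ≡ f v
  Reach-invariant f inv (here _) = refl
  Reach-invariant f inv (step gu gw (_ , _ , inj₁ e) r) =
    trans (inv gu e) (Reach-invariant f inv r)
  Reach-invariant f inv (step gu gw (_ , _ , inj₂ e) r) =
    trans (sym (inv gw e)) (Reach-invariant f inv r)

  isClusterDeletion-if-blocks-separated :
    ∀ {S} → (∀ {u w} → InGminus S u → E u w → block u ≡ block w) → IsClusterDeletion S
  isClusterDeletion-if-blocks-separated separated u v r with Reach-valid r
  ... | vu , vv = block-isClique (inBlock u) v∈block-u vu vv
    where
    v∈block-u : InBlock (block u) v
    v∈block-u = subst (λ b → InBlock b v) (sym (Reach-invariant block separated r)) (inBlock v)

  separator : ℕ → List V
  separator i = lv i 1 ∷ rv i B ∷ xv (2 * i * B + B + 1) ∷ yv (2 * i * B ∸ B) ∷ []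

  separators : ℕ → List V
  separators zero    = []
  separators (suc m) = separator (suc m) ++ separators m

  length-separators : ∀ m → length (separators m) ≡ 4 * m
  length-separators zero    = refl
  length-separators (suc m) =
    trans (length-++ (separator (suc m)) {separators m}) (trans (cong (4 +_) (length-separators m)) (sym (*-suc 4 m)))

  separator⊆separators : ∀ {i m v} → i ∈[ 1 , m ] → v ∈ separator i → v ∈ separators m
  separator⊆separators {m = zero} (s≤s _ , ())
  separator⊆separators {i} {suc m} (1≤i , i≤1+m) v∈ with i ≟ suc m
  ... | yes refl = ∈-++⁺ˡ v∈
  ... | no i≢1+m = ∈-++⁺ʳ (separator (suc m))
                     (separator⊆separators (1≤i , m<1+n⇒m≤n (≤∧≢⇒< i≤1+m i≢1+m)) v∈)

  deletionSet : List V
  deletionSet = xv (2 * k * B + B) ∷ yv 1 ∷ separators k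

  separator⊆deletionSet : ∀ {i v} → i ∈[ 1 , k ] → v ∈ separator i → v ∈ deletionSet
  separator⊆deletionSet i∈ v∈ = there (there (separator⊆separators i∈ v∈))

  length-deletionSet : 1 ≤ k → length deletionSet ≤ 6 * k
  length-deletionSet 1≤k = begin
    2 + length (separators k) ≡⟨ cong (2 +_) (length-separators k) ⟩
    2 + 4 * k                 ≤⟨ +-monoˡ-≤ (4 * k) (*-monoʳ-≤ 2 1≤k) ⟩
    2 * k + 4 * k             ≡⟨ sym (*-distribʳ-+ k 2 4) ⟩
    6 * k                     ∎
    where open ≤-Reasoning

  blocks-separated : 1 ≤ k → ∀ {u w} → InGminus deletionSet u → E u w → block u ≡ block w
  blocks-separated _ _ (xx _)  = refl
  blocks-separated _ _ (yy _)  = refl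
  blocks-separated _ _ (ll _)  = refl
  blocks-separated _ _ (rr _)  = refl
  blocks-separated _ _ lr      = refl
  blocks-separated _ _ (aLL _) = refl
  blocks-separated _ _ (aRR _) = refl
  blocks-separated _ _ aLR     = refl
  blocks-separated _ ((i∈ , _) , u∉D) (l1X _) =
    ⊥-elim (u∉D (separator⊆deletionSet i∈ (here refl)))
  blocks-separated _ ((i∈ , _) , u∉D) (rBY _) =
    ⊥-elim (u∉D (separator⊆deletionSet i∈ (there (here refl))))
  blocks-separated _ (_ , u∉D) (xL (1≤i , i≤k-1)) =
    ⊥-elim (u∉D (separator⊆deletionSet (1≤i , ≤-trans i≤k-1 (m∸n≤m k 1)) (there (there (here refl)))))
  blocks-separated _ (_ , u∉D) (yR (2≤i , i≤k)) =
    ⊥-elim (u∉D (separator⊆deletionSet (≤-trans (s≤s z≤n) 2≤i , i≤k) (there (there (there (here refl))))))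
  blocks-separated _ (_ , u∉D) xLk = ⊥-elim (u∉D (here refl))
  blocks-separated _ (_ , u∉D) xA  = ⊥-elim (u∉D (here refl))
  blocks-separated _ (_ , u∉D) y1R = ⊥-elim (u∉D (there (here refl)))
  blocks-separated _ (_ , u∉D) yA  = ⊥-elim (u∉D (there (here refl)))

lemma16 : ∃[ c ] ((As : List ℕ) (k B : ℕ) → 1 ≤ k → sum As ≡ k * B →
    Construction.CvdAtMost As k B (c * k))
lemma16 = 6 , λ As k B 1≤k _ →
  deletionSet As k B ,
  length-deletionSet As k B 1≤k ,
  isClusterDeletion-if-blocks-separated As k B (blocks-separated As k B 1≤k)
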